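{- Let $n\geq 3$. If $G=P_t$ with $t\geq 2$ or $G=C_t$ with $t\geq 3$, then \[\gamma_P(G\times K_n)\leq \begin{cases} \left\lceil \frac t2\right\rceil & \text{if } t\not\equiv 2 \pmod 4, \\ \frac t2 + 1 & \text{if } t \equiv 2 \pmod 4. \end{cases}\]
   Context: All graphs are finite, simple and undirected. $P_t$ is the path on $t$ vertices, $C_t$ the cycle on $t$ vertices, $K_n$ the complete graph on $n$ vertices. The tensor product $G\times H$ has vertex set $V(G)\times V(H)$, with $(g,h)$ adjacent to $(g',h')$ iff $g\sim g'$ in $G$ and $h\sim h'$ in $H$. Power domination: for $S\subseteq V(G)$ define $PD(S)$ by first setting $PD(S):=N[S]$ (the closed neighborhood of $S$), and then, while there is a vertex $v\in PD(S)$ with exactly one neighbor outside $PD(S)$, adding all neighbors of $v$ to $PD(S)$. $S$ is a power dominating set if at the end $PD(S)=V(G)$; $\gamma_P(G)$ is the minimum cardinality of a power dominating set. -}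

module Defs where

open import Level using (0ℓ)
open import Data.Nat using (ℕ; zero; suc; _≤_; _+_; ⌈_/2⌉; ⌊_/2⌋)
open import Data.Nat.DivMod using (_%_)
open import Data.Fin using (Fin; toℕ)
open import Data.Product using (Σ; _×_; _,_)
open import Data.Sum using (_⊎_)
open import Data.List using (List; length)
open import Data.List.Membership.Propositional using (_∈_)
open import Relation.Binary.PropositionalEquality using (_≡_; _≢_)
open import Relation.Nullary using (Dec; yes; no)
open import Data.Nat using (_≟_)

record Graph : Set₁ where
  field
    V   : Set
    _~_ : V → V → Set
open Graph public

pathAdj : (t : ℕ) → Fin t → Fin t → Set
pathAdj t i j = (suc (toℕ i) ≡ toℕ j) ⊎ (suc (toℕ j) ≡ toℕ i)

Path : ℕ → Graph
Path t = record { V = Fin t ; _~_ = pathAdj t }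

cycleAdj : (t : ℕ) → Fin t → Fin t → Set
cycleAdj t i j = pathAdj t i j
               ⊎ ((toℕ i ≡ 0 × suc (toℕ j) ≡ t) ⊎ (toℕ j ≡ 0 × suc (toℕ i) ≡ t))

Cycle : ℕ → Graph
Cycle t = record { V = Fin t ; _~_ = cycleAdj t }

Complete : ℕ → Graph
Complete n = record { V = Fin n ; _~_ = λ i j → i ≢ j }

_⊗_ : Graph → Graph → Graph
G ⊗ H = record { V = V G × V H
               ; _~_ = λ { (g , h) (g' , h') → (_~_ G g g') × (_~_ H h h') } }

-- PD(S) as the least set closed under the rules of the power domination
-- process: N[S] ⊆ PD(S), and if v ∈ PD(S) has all neighbours except w in
-- PD(S), then w ∈ PD(S).
data Observed (G : Graph) (S : List (V G)) : V G → Set where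
  obs-self  : ∀ {x} → x ∈ S → Observed G S x
  obs-nbr   : ∀ {x y} → x ∈ S → _~_ G x y → Observed G S y
  obs-force : ∀ {v w} → Observed G S v → _~_ G v w
            → (∀ u → _~_ G v u → u ≢ w → Observed G S u)
            → Observed G S w

IsPowerDominating : (G : Graph) → List (V G) → Set
IsPowerDominating G S = ∀ v → Observed G S v

γP≤ : Graph → ℕ → Set
γP≤ G k = Σ (List (V G)) (λ S → (length S ≤ k) × IsPowerDominating G S)

bound : ℕ → ℕ
bound t with t % 4 ≟ 2
... | yes _ = ⌊ t /2⌋ + 1
... | no  _ = ⌈ t /2⌉

-- Seed the K_n-layers over the vertices 4q+1 and 4q+2 of each block of four
-- consecutive vertices of the path, at the vertex 0 of K_n.  Two adjacent
-- seeded layers observe each other completely ((g, a) with a ≠ 0 is a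
-- neighbour of the other seed), and an observed seeded layer over an
-- interior vertex forces the layer on its far side, which fills the outer
-- vertices 4q and 4q+3 of every block.  The last t mod 4 vertices need
-- one extra seed when t ≡ 1 and two when t ≡ 2 (mod 4).
module Submission where

open import Defs
open import Data.Nat using (ℕ; zero; suc; z<s; _+_; _*_; _<_; _≤_; z≤n; s≤s; _<?_; _/_; _%_; ⌊_/2⌋; ⌈_/2⌉)
open import Data.Nat.Properties
open import Data.Nat.DivMod using (m≡m%n+[m/n]*n; m%n<n; [m+kn]%n≡m%n)
open import Data.Fin as Fin using (Fin; toℕ; fromℕ<)
open import Data.Fin.Properties using (toℕ-injective; toℕ<n; toℕ-fromℕ<)
open import Data.Product using (_×_; _,_; proj₁; proj₂)
open import Data.Sum using (_⊎_; inj₁; inj₂)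
open import Data.List using (List; []; _∷_; length)
open import Data.List.Membership.Propositional using (_∈_)
open import Data.List.Relation.Binary.Subset.Propositional using (_⊆_)
open import Data.List.Relation.Unary.Any using (here; there)
open import Data.Empty using (⊥-elim)
open import Function using (_∘_; id)
open import Relation.Nullary using (yes; no)
open import Relation.Binary.Definitions using (tri<; tri≈; tri>)
open import Relation.Binary.PropositionalEquality
  using (_≡_; _≢_; refl; sym; trans; cong; subst; module ≡-Reasoning)

module LayerForcing (G : Graph) (n : ℕ) where

  private
    H : Graph
    H = G ⊗ Complete (suc (suc n))

  LayerObserved : List (V H) → V G → Set
  LayerObserved S g = ∀ a → Observed H S (g , a)

  module _ {S : List (V H)} where

    seed-neighbour : ∀ {g h a} → (g , Fin.zero) ∈ S → _~_ G g h → a ≢ Fin.zero → Observed H S (h , a)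
    seed-neighbour g∈S g~h a≢0 = obs-nbr g∈S (g~h , λ 0≡a → a≢0 (sym 0≡a))

    layer-observed-by-seed-pair : ∀ {g h} → (g , Fin.zero) ∈ S → (h , Fin.zero) ∈ S → _~_ G h g
                                → LayerObserved S g
    layer-observed-by-seed-pair g∈S h∈S h~g a with a Fin.≟ Fin.zero
    ... | yes refl = obs-self g∈S
    ... | no a≢0   = seed-neighbour h∈S h~g a≢0

    -- (g, 1) forces (h, 0): its neighbours (g', c) with c ≠ 0 are neighbours
    -- of the seed (g, 0), and those with c = 0 and g' ≠ h lie in observed layers.
    layer-forced : ∀ {g h} → (g , Fin.zero) ∈ S → LayerObserved S g → _~_ G g h
                 → (∀ g' → _~_ G g g' → g' ≢ h → LayerObserved S g')
                 → LayerObserved S h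
    layer-forced {g} {h} g∈S g-observed g~h others a with a Fin.≟ Fin.zero
    ... | no a≢0   = seed-neighbour g∈S g~h a≢0
    ... | yes refl = obs-force (g-observed (Fin.suc Fin.zero)) (g~h , λ ()) rest
      where
        rest : ∀ u → _~_ H (g , Fin.suc Fin.zero) u → u ≢ (h , Fin.zero) → Observed H S u
        rest (g' , c) (g~g' , _) u≢h0 with c Fin.≟ Fin.zero
        ... | yes refl = others g' g~g' (λ g'≡h → u≢h0 (cong (_, Fin.zero) g'≡h)) Fin.zero
        ... | no c≢0   = seed-neighbour g∈S g~g' c≢0

blockSeeds : ℕ → List ℕ
blockSeeds zero    = []
blockSeeds (suc q) = 1 + q * 4 ∷ 2 + q * 4 ∷ blockSeeds q

-- The seeds for t = r + k * 4 with r < 4; the case r = 1 needs k ≥ 1, i.e. t ≥ 2.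
seeds : ℕ → ℕ → List ℕ
seeds k       0 = blockSeeds k
seeds k       2 = k * 4 ∷ 1 + k * 4 ∷ blockSeeds k
seeds k       3 = blockSeeds (suc k)
seeds zero    1 = []
seeds (suc q) 1 = 3 + q * 4 ∷ blockSeeds (suc q)
seeds k       _ = blockSeeds k

blockSeeds-∈ : ∀ {q k} → q < k → 1 + q * 4 ∈ blockSeeds k × 2 + q * 4 ∈ blockSeeds k
blockSeeds-∈ {q} {suc k} (s≤s q≤k) with m≤n⇒m<n∨m≡n q≤k
... | inj₂ refl = here refl , there (here refl)
... | inj₁ q<k  = let (1+q*4∈ , 2+q*4∈) = blockSeeds-∈ q<k in there (there 1+q*4∈) , there (there 2+q*4∈)

blockSeeds⊆seeds : ∀ k r → blockSeeds k ⊆ seeds k r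
blockSeeds⊆seeds k       0                         = id
blockSeeds⊆seeds zero    1                         = id
blockSeeds⊆seeds (suc q) 1                         = there
blockSeeds⊆seeds k       2                         = there ∘ there
blockSeeds⊆seeds k       3                         = there ∘ there
blockSeeds⊆seeds k       (suc (suc (suc (suc _)))) = id

length-blockSeeds : ∀ k → length (blockSeeds k) ≡ k * 2
length-blockSeeds zero    = refl
length-blockSeeds (suc k) = cong (2 +_) (length-blockSeeds k)

⌊k*4/2⌋≡k*2 : ∀ k → ⌊ k * 4 /2⌋ ≡ k * 2
⌊k*4/2⌋≡k*2 k = trans (cong ⌊_/2⌋ (*-distribˡ-+ k 2 2)) (sym (n≡⌊n+n/2⌋ (k * 2)))

⌈k*4/2⌉≡k*2 : ∀ k → ⌈ k * 4 /2⌉ ≡ k * 2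
⌈k*4/2⌉≡k*2 k = trans (cong ⌈_/2⌉ (*-distribˡ-+ k 2 2)) (sym (n≡⌈n+n/2⌉ (k * 2)))

bound≡⌈t/2⌉ : ∀ r k → r % 4 ≢ 2 → bound (r + k * 4) ≡ ⌈ r + k * 4 /2⌉
bound≡⌈t/2⌉ r k r%4≢2 with (r + k * 4) % 4 ≟ 2
... | yes t%4≡2 = ⊥-elim (r%4≢2 (trans (sym ([m+kn]%n≡m%n r k 4)) t%4≡2))
... | no _      = refl

bound≡⌊t/2⌋+1 : ∀ k → bound (2 + k * 4) ≡ ⌊ 2 + k * 4 /2⌋ + 1
bound≡⌊t/2⌋+1 k with (2 + k * 4) % 4 ≟ 2
... | yes _     = refl
... | no t%4≢2 = ⊥-elim (t%4≢2 ([m+kn]%n≡m%n 2 k 4))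

length-seeds : ∀ k r → r < 4 → length (seeds k r) ≤ bound (r + k * 4)
length-seeds k       0 _ = ≤-reflexive (begin
  length (blockSeeds k) ≡⟨ length-blockSeeds k ⟩
  k * 2                 ≡⟨ ⌈k*4/2⌉≡k*2 k ⟨
  ⌈ k * 4 /2⌉           ≡⟨ bound≡⌈t/2⌉ 0 k (λ ()) ⟨
  bound (k * 4)         ∎)
  where open ≡-Reasoning
length-seeds zero    1 _ = z≤n
length-seeds (suc q) 1 _ = ≤-reflexive (begin
  suc (length (blockSeeds (suc q))) ≡⟨ cong suc (length-blockSeeds (suc q)) ⟩
  suc (suc q * 2)                   ≡⟨ cong suc (⌊k*4/2⌋≡k*2 (suc q)) ⟨
  ⌈ 1 + suc q * 4 /2⌉               ≡⟨ bound≡⌈t/2⌉ 1 (suc q) (λ ()) ⟨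
  bound (1 + suc q * 4)             ∎)
  where open ≡-Reasoning
length-seeds k       2 _ = ≤-reflexive (begin
  2 + length (blockSeeds k) ≡⟨ cong (2 +_) (length-blockSeeds k) ⟩
  2 + k * 2                 ≡⟨ +-comm 1 (suc (k * 2)) ⟩
  suc (k * 2) + 1           ≡⟨ cong (λ m → suc m + 1) (⌊k*4/2⌋≡k*2 k) ⟨
  ⌊ 2 + k * 4 /2⌋ + 1       ≡⟨ bound≡⌊t/2⌋+1 k ⟨
  bound (2 + k * 4)         ∎)
  where open ≡-Reasoning
length-seeds k       3 _ = ≤-reflexive (begin
  length (blockSeeds (suc k)) ≡⟨ length-blockSeeds (suc k) ⟩
  2 + k * 2                   ≡⟨ cong (2 +_) (⌊k*4/2⌋≡k*2 k) ⟨
  ⌈ 3 + k * 4 /2⌉             ≡⟨ bound≡⌈t/2⌉ 3 k (λ ()) ⟨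
  bound (3 + k * 4)           ∎)
  where open ≡-Reasoning
length-seeds k       (suc (suc (suc (suc _)))) (s≤s (s≤s (s≤s (s≤s ()))))

-- A graph on Fin t containing the edges of P_t and agreeing with P_t at every
-- vertex other than 0 and t − 1; both P_t and C_t qualify.
record PathLike {t : ℕ} (A : Fin t → Fin t → Set) : Set where
  field
    path-edge : ∀ {i j} → pathAdj t i j → A i j
    interior  : ∀ {i j} → 0 < toℕ i → suc (toℕ i) < t → A i j → pathAdj t i j

module Spine {t : ℕ} {A : Fin t → Fin t → Set} (pathLike : PathLike A) (n : ℕ) where
  open PathLike pathLike

  G : Graph
  G = record { V = Fin t ; _~_ = A }

  open LayerForcing G n

  seedVertices : List ℕ → List (Fin t × Fin (suc (suc n)))
  seedVertices []       = []
  seedVertices (m ∷ ms) with m <? t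
  ... | yes m<t = (fromℕ< m<t , Fin.zero) ∷ seedVertices ms
  ... | no _    = seedVertices ms

  length-seedVertices : ∀ ms → length (seedVertices ms) ≤ length ms
  length-seedVertices []       = z≤n
  length-seedVertices (m ∷ ms) with m <? t
  ... | yes _ = s≤s (length-seedVertices ms)
  ... | no _  = m≤n⇒m≤1+n (length-seedVertices ms)

  ∈-seedVertices : ∀ {i m ms} → toℕ i ≡ m → m ∈ ms → (i , Fin.zero) ∈ seedVertices ms
  ∈-seedVertices {i} {ms = m ∷ ms} i≡m (here refl) with m <? t
  ... | yes m<t = here (cong (_, Fin.zero) (toℕ-injective (trans i≡m (sym (toℕ-fromℕ< m<t)))))
  ... | no m≮t  = ⊥-elim (m≮t (subst (_< t) i≡m (toℕ<n i)))
  ∈-seedVertices {ms = m ∷ ms} i≡m (there m∈ms) with m <? t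
  ... | yes _ = there (∈-seedVertices i≡m m∈ms)
  ... | no _  = ∈-seedVertices i≡m m∈ms

  Covered : List ℕ → ℕ → Set
  Covered ms m = ∀ i → toℕ i ≡ m → LayerObserved (seedVertices ms) i

  path-edge-at : ∀ {i j m} → toℕ i ≡ m → toℕ j ≡ suc m → A i j × A j i
  path-edge-at i≡m j≡1+m = path-edge (inj₁ step) , path-edge (inj₂ step)
    where step = trans (cong suc i≡m) (sym j≡1+m)

  interior-neighbour : ∀ {i j p} → toℕ i ≡ suc p → 2 + p < t → A i j
                     → toℕ j ≡ p ⊎ toℕ j ≡ 2 + p
  interior-neighbour i≡1+p 2+p<t i~j
    with interior (subst (0 <_) (sym i≡1+p) z<s) (subst (λ m → suc m < t) (sym i≡1+p) 2+p<t) i~j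
  ... | inj₁ 1+i≡j = inj₂ (trans (sym 1+i≡j) (cong suc i≡1+p))
  ... | inj₂ 1+j≡i = inj₁ (suc-injective (trans 1+j≡i i≡1+p))

  module _ {ms : List ℕ} where

    seed-pair-covered : ∀ {m} → m ∈ ms → suc m ∈ ms → suc m < t → Covered ms m × Covered ms (suc m)
    seed-pair-covered {m} m∈ms 1+m∈ms 1+m<t =
      (λ i i≡m → layer-observed-by-seed-pair (∈-seedVertices i≡m m∈ms) (∈-seedVertices toℕ-next 1+m∈ms)
                                             (proj₂ (path-edge-at i≡m toℕ-next))) ,
      (λ j j≡1+m → layer-observed-by-seed-pair (∈-seedVertices j≡1+m 1+m∈ms) (∈-seedVertices toℕ-this m∈ms)
                                               (proj₁ (path-edge-at toℕ-this j≡1+m)))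
      where
        toℕ-this = toℕ-fromℕ< (<-trans (n<1+n m) 1+m<t)
        toℕ-next = toℕ-fromℕ< 1+m<t

    forced-up : ∀ {p} → suc p ∈ ms → 2 + p < t → Covered ms p → Covered ms (suc p) → Covered ms (2 + p)
    forced-up {p} 1+p∈ms 2+p<t covered-p covered-1+p j j≡2+p =
      layer-forced (∈-seedVertices toℕ-mid 1+p∈ms) (covered-1+p mid toℕ-mid)
                   (proj₁ (path-edge-at toℕ-mid j≡2+p)) others
      where
        mid = fromℕ< (<-trans (n<1+n (suc p)) 2+p<t)
        toℕ-mid = toℕ-fromℕ< (<-trans (n<1+n (suc p)) 2+p<t)
        others : ∀ g → A mid g → g ≢ j → LayerObserved (seedVertices ms) g
        others g mid~g g≢j with interior-neighbour toℕ-mid 2+p<t mid~g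
        ... | inj₁ g≡p   = covered-p g g≡p
        ... | inj₂ g≡2+p = ⊥-elim (g≢j (toℕ-injective (trans g≡2+p (sym j≡2+p))))

    forced-down : ∀ {p} → suc p ∈ ms → 2 + p < t → Covered ms (suc p) → Covered ms (2 + p) → Covered ms p
    forced-down {p} 1+p∈ms 2+p<t covered-1+p covered-2+p j j≡p =
      layer-forced (∈-seedVertices toℕ-mid 1+p∈ms) (covered-1+p mid toℕ-mid)
                   (proj₂ (path-edge-at j≡p toℕ-mid)) others
      where
        mid = fromℕ< (<-trans (n<1+n (suc p)) 2+p<t)
        toℕ-mid = toℕ-fromℕ< (<-trans (n<1+n (suc p)) 2+p<t)
        others : ∀ g → A mid g → g ≢ j → LayerObserved (seedVertices ms) g
        others g mid~g g≢j with interior-neighbour toℕ-mid 2+p<t mid~g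
        ... | inj₁ g≡p   = ⊥-elim (g≢j (toℕ-injective (trans g≡p (sym j≡p))))
        ... | inj₂ g≡2+p = covered-2+p g g≡2+p

    block-covered : ∀ {p} → suc p ∈ ms → 2 + p ∈ ms → 2 + p < t
                  → ∀ s → s < 4 → s + p < t → Covered ms (s + p)
    block-covered 1+p∈ms 2+p∈ms 2+p<t = λ where
        0 _ _     → forced-down 1+p∈ms 2+p<t covered-1+p covered-2+p
        1 _ _     → covered-1+p
        2 _ _     → covered-2+p
        3 _ 3+p<t → forced-up 2+p∈ms 3+p<t covered-1+p covered-2+p
        (suc (suc (suc (suc _)))) (s≤s (s≤s (s≤s (s≤s ())))) _
      where
        covered-1+p = proj₁ (seed-pair-covered 1+p∈ms 2+p∈ms 2+p<t)
        covered-2+p = proj₂ (seed-pair-covered 1+p∈ms 2+p∈ms 2+p<t)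

  block-in-range : ∀ {k r q} → t ≡ r + k * 4 → q < k → ∀ s → s < 4 → s + q * 4 < t
  block-in-range {k} {r} {q} t≡r+k*4 q<k s s<4 = begin-strict
    s + q * 4 <⟨ +-monoˡ-< (q * 4) s<4 ⟩
    suc q * 4 ≤⟨ *-monoˡ-≤ 4 q<k ⟩
    k * 4     ≤⟨ m≤n+m (k * 4) r ⟩
    r + k * 4 ≡⟨ t≡r+k*4 ⟨
    t         ∎
    where open ≤-Reasoning

  full-block-covered : ∀ {k r q} → t ≡ r + k * 4 → q < k → ∀ s → s < 4 → Covered (seeds k r) (s + q * 4)
  full-block-covered {k} {r} t≡r+k*4 q<k s s<4 =
    block-covered (blockSeeds⊆seeds k r 1+q*4∈) (blockSeeds⊆seeds k r 2+q*4∈)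
                  (block-in-range t≡r+k*4 q<k 2 (s≤s (s≤s (s≤s z≤n))))
                  s s<4 (block-in-range t≡r+k*4 q<k s s<4)
    where
      1+q*4∈ = proj₁ (blockSeeds-∈ q<k)
      2+q*4∈ = proj₂ (blockSeeds-∈ q<k)

  last-block-covered : ∀ k r → r < 4 → 2 ≤ t → t ≡ r + k * 4 → ∀ s → s < r → Covered (seeds k r) (s + k * 4)
  last-block-covered zero    1 _ 2≤t t≡1 0 _ with subst (2 ≤_) t≡1 2≤t
  ... | s≤s ()
  last-block-covered (suc q) 1 _ _ t≡r+k*4 0 _ =
    forced-up (here refl) (≤-reflexive (sym t≡r+k*4))
              (full-block-covered {r = 1} t≡r+k*4 (n<1+n q) 2 (s≤s (s≤s (s≤s z≤n))))
              (full-block-covered {r = 1} t≡r+k*4 (n<1+n q) 3 ≤-refl)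
  last-block-covered k 2 _ _ t≡r+k*4 0 _ =
    proj₁ (seed-pair-covered (here refl) (there (here refl)) (≤-reflexive (sym t≡r+k*4)))
  last-block-covered k 2 _ _ t≡r+k*4 1 _ =
    proj₂ (seed-pair-covered (here refl) (there (here refl)) (≤-reflexive (sym t≡r+k*4)))
  last-block-covered k 3 _ _ t≡r+k*4 s s<3 =
    block-covered (here refl) (there (here refl)) (≤-reflexive (sym t≡r+k*4)) s (m<n⇒m<1+n s<3)
                  (subst (s + k * 4 <_) (sym t≡r+k*4) (+-monoˡ-< (k * 4) s<3))
  last-block-covered k 1 _ _ _ (suc _) (s≤s ())
  last-block-covered k 2 _ _ _ (suc (suc _)) (s≤s (s≤s ()))
  last-block-covered k (suc (suc (suc (suc _)))) (s≤s (s≤s (s≤s (s≤s ())))) _ _ _ _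

  seeds-cover : ∀ {k r} → r < 4 → 2 ≤ t → t ≡ r + k * 4 → ∀ i → LayerObserved (seedVertices (seeds k r)) i
  seeds-cover {k} {r} r<4 2≤t t≡r+k*4 i =
    covered (toℕ i / 4) (toℕ i % 4) (m%n<n (toℕ i) 4) (subst (_< t) i≡ (toℕ<n i)) i i≡
    where
      i≡ = m≡m%n+[m/n]*n (toℕ i) 4
      covered : ∀ q s → s < 4 → s + q * 4 < t → Covered (seeds k r) (s + q * 4)
      covered q s s<4 s+q*4<t with <-cmp q k
      ... | tri< q<k _ _  = full-block-covered t≡r+k*4 q<k s s<4
      ... | tri≈ _ refl _ = last-block-covered k r r<4 2≤t t≡r+k*4 s
                              (+-cancelʳ-< (k * 4) s r (subst (s + k * 4 <_) t≡r+k*4 s+q*4<t))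
      ... | tri> _ _ k<q  = ⊥-elim (<⇒≱ s+q*4<t (begin
        t         ≡⟨ t≡r+k*4 ⟩
        r + k * 4 ≤⟨ +-monoˡ-≤ (k * 4) (<⇒≤ r<4) ⟩
        suc k * 4 ≤⟨ *-monoˡ-≤ 4 k<q ⟩
        q * 4     ≤⟨ m≤n+m (q * 4) s ⟩
        s + q * 4 ∎))
        where open ≤-Reasoning

  pathLike-γP≤ : 2 ≤ t → γP≤ (G ⊗ Complete (suc (suc n))) (bound t)
  pathLike-γP≤ 2≤t = seedVertices (seeds k r) , size , λ (i , a) → seeds-cover r<4 2≤t t≡r+k*4 i a
    where
      k = t / 4
      r = t % 4
      r<4 = m%n<n t 4
      t≡r+k*4 = m≡m%n+[m/n]*n t 4
      size : length (seedVertices (seeds k r)) ≤ bound t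
      size = ≤-trans (length-seedVertices (seeds k r))
                     (subst (λ m → length (seeds k r) ≤ bound m) (sym t≡r+k*4) (length-seeds k r r<4))

pathLike-path : ∀ t → PathLike (pathAdj t)
pathLike-path t = record { path-edge = id ; interior = λ _ _ i~j → i~j }

pathLike-cycle : ∀ t → PathLike (cycleAdj t)
pathLike-cycle t = record { path-edge = inj₁ ; interior = interior }
  where
    interior : ∀ {i j} → 0 < toℕ i → suc (toℕ i) < t → cycleAdj t i j → pathAdj t i j
    interior _     _     (inj₁ i~j)                = i~j
    interior 0<i   _     (inj₂ (inj₁ (i≡0 , _)))   = ⊥-elim (<-irrefl (sym i≡0) 0<i)
    interior _     1+i<t (inj₂ (inj₂ (_ , 1+i≡t))) = ⊥-elim (<-irrefl 1+i≡t 1+i<t)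

proposition3p4 : (n : ℕ) → 3 ≤ n → (t : ℕ)
    → (2 ≤ t → γP≤ (Path t ⊗ Complete n) (bound t))
    × (3 ≤ t → γP≤ (Cycle t ⊗ Complete n) (bound t))
proposition3p4 (suc (suc n)) (s≤s (s≤s (s≤s _))) t =
  Spine.pathLike-γP≤ (pathLike-path t) n ,
  λ 3≤t → Spine.pathLike-γP≤ (pathLike-cycle t) n (≤-trans (n≤1+n 2) 3≤t)
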